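{- Let $\mathbf{C}$ be an even snowflake with $M$ edges whose center $z$ has even degree. If $M\equiv 0\pmod 4$, then $\mathbf{C}$ admits an Eulerian conservative labeling; otherwise $\mathbf{C}$ admits an Eulerian near-conservative labeling.
   Context: A snowflake is the tree obtained from a disjoint union of stars $S_1,\ldots,S_p$ ($S_i\cong K_{1,n_i}$, $n_i\geq 3$) by identifying one leaf of each star into a single vertex $z$, the center. An internal vertex is a vertex of degree at least $2$. A snowflake is even if every internal vertex other than possibly the center has even degree. A labeling is a bijection from the edge set to a set of positive integers of the same size; $[a,b]=\{a,\ldots,b\}$. Given an orientation and labeling $\phi$, the vertex-sum $s(u)$ is the sum of labels of arcs entering $u$ minus the sum of labels of arcs leaving $u$. For a graph with $M$ edges, a conservative labeling is an (orientation, labeling) pair with label set $[1,M]$ and $s(u)=0$ at every vertex of degree at least $3$; a near-conservative labeling is the same with label set $[1,M-1]\cup\{M+1\}$. Such a labeling is Eulerian if in its orientation every internal vertex has equal in-degree and out-degree. -}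

module Defs where

open import Data.Nat as ℕ using (ℕ; zero; suc; _≤_; _<_; _%_)
open import Data.Nat.Divisibility using (_∣_)
open import Data.Integer as ℤ using (ℤ; +_; -_)
open import Data.Fin using (Fin; zero; suc)
open import Data.Bool using (Bool; true; false; not; if_then_else_)
open import Data.Product using (Σ; ∃; _×_; _,_)
open import Data.Sum using (_⊎_)
open import Function.Definitions using (Injective)
open import Relation.Binary.PropositionalEquality using (_≡_)

Σℕ : (k : ℕ) → (Fin k → ℕ) → ℕ
Σℕ zero    f = 0
Σℕ (suc k) f = f zero ℕ.+ Σℕ k (λ i → f (suc i))

Σℤ : (k : ℕ) → (Fin k → ℤ) → ℤ
Σℤ zero    f = + 0
Σℤ (suc k) f = f zero ℤ.+ Σℤ k (λ i → f (suc i))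

Even : ℕ → Set
Even n = 2 ∣ n

-- The snowflake with p stars S_i ≅ K_{1, n i}.
-- Vertices: the center z; the star centers c_i; the leaves.
-- Edges of star i are indexed by Fin (n i):
--   edge (i , zero)  joins c_i to z   (the identified leaf of S_i),
--   edge (i , suc j) joins c_i to a private leaf.

module Snowflake (p : ℕ) (n : Fin p → ℕ) where

  isZ : ∀ {k} → Fin k → Bool
  isZ zero    = true
  isZ (suc _) = false

  Edge : Set
  Edge = Σ (Fin p) (λ i → Fin (n i))

  M : ℕ
  M = Σℕ p n

  -- An orientation: true  = the arc of edge (i , j) points INTO c_i,
  --                 false = the arc points OUT of c_i (into the other end).
  Orientation : Set
  Orientation = Edge → Bool

  atStarCenter : Bool → ℕ → ℤ
  atStarCenter true  l = + l
  atStarCenter false l = - (+ l)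

  atZ : Bool → ℕ → ℤ
  atZ true  l = - (+ l)
  atZ false l = + l

  sumC : Orientation → (Edge → ℕ) → Fin p → ℤ
  sumC o φ i = Σℤ (n i) (λ j → atStarCenter (o (i , j)) (φ (i , j)))

  sumZ : Orientation → (Edge → ℕ) → ℤ
  sumZ o φ = Σℤ p (λ i → Σℤ (n i) (λ j →
               if isZ j then atZ (o (i , j)) (φ (i , j)) else + 0))

  b2n : Bool → ℕ
  b2n true  = 1
  b2n false = 0

  inC outC : Orientation → Fin p → ℕ
  inC  o i = Σℕ (n i) (λ j → b2n (o (i , j)))
  outC o i = Σℕ (n i) (λ j → b2n (not (o (i , j))))

  inZ outZ : Orientation → ℕ
  inZ  o = Σℕ p (λ i → Σℕ (n i) (λ j → if isZ j then b2n (not (o (i , j))) else 0))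
  outZ o = Σℕ p (λ i → Σℕ (n i) (λ j → if isZ j then b2n (o (i , j)) else 0))

  IsLabeling : (ℕ → Set) → (Edge → ℕ) → Set
  IsLabeling S φ = Injective _≡_ _≡_ φ
                 × (∀ e → S (φ e))
                 × (∀ l → S l → ∃ λ e → φ e ≡ l)

  ConsSet : ℕ → Set
  ConsSet l = 1 ≤ l × l ≤ M

  NearSet : ℕ → Set
  NearSet l = (1 ≤ l × l ℕ.+ 1 ≤ M) ⊎ l ≡ suc M

  -- s(u) = 0 at every vertex of degree ≥ 3
  -- (every c_i has degree n i; z has degree p; leaves have degree 1)
  ZeroSums : Orientation → (Edge → ℕ) → Set
  ZeroSums o φ = (∀ i → 3 ≤ n i → sumC o φ i ≡ + 0)
               × (3 ≤ p → sumZ o φ ≡ + 0)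

  -- in-degree = out-degree at every internal vertex (degree ≥ 2)
  IsEulerian : Orientation → Set
  IsEulerian o = (∀ i → 2 ≤ n i → inC o i ≡ outC o i)
               × (2 ≤ p → inZ o ≡ outZ o)

  EulerianConservative : Set
  EulerianConservative =
    Σ Orientation λ o → Σ (Edge → ℕ) λ φ →
      IsLabeling ConsSet φ × ZeroSums o φ × IsEulerian o

  EulerianNearConservative : Set
  EulerianNearConservative =
    Σ Orientation λ o → Σ (Edge → ℕ) λ φ →
      IsLabeling NearSet φ × ZeroSums o φ × IsEulerian o

-- Give the stars consecutive blocks of labels and give the edges of each star,
-- in increasing order of label, the signs + − − + + − − + …: every four
-- consecutive labels then contribute 0 to the vertex-sum of the star centre,
-- and in- and out-degrees agree.  A block of n ≡ 2 (mod 4) consecutive labels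
-- has odd sum and cannot be balanced, so such a star exchanges its largest
-- label with the smallest label of the next block (a carry) and flips one pair
-- of signs; the carries propagate, and the last label is M + 1 instead of M
-- exactly when M ≡ 2 (mod 4).  Permuting the edges of a star and negating all
-- its signs keep it balanced, so the edge from each star to z can be given any
-- label of its block and either direction: in each pair of consecutive stars
-- the two z-edges get labels x, x + 1 (or x, x + 2) and opposite directions,
-- contributing ±1 (or +2) to s(z), and these contributions are chosen to
-- cancel.  Being injective into a set of M labels, the labelling is bijective.

module Submission where

open import Defs
open import Data.Nat using (ℕ; zero; suc; _+_; _*_; _≤_; _<_; z≤n; s≤s; pred; _%_; _≤ᵇ_; _<ᵇ_)
import Data.Nat.Properties as ℕₚ
open import Data.Nat.DivMod using ([m+n]%n≡m%n)
open import Data.Nat.Divisibility using (divides)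
open import Data.Integer using (ℤ; +_; -_; _-_) renaming (_+_ to _⊕_)
import Data.Integer.Properties as ℤₚ
open import Data.Integer.Tactic.RingSolver using (solve-∀)
open import Data.Nat.Tactic.RingSolver using () renaming (solve-∀ to solve-∀ℕ)
open import Data.Fin as Fin using (Fin; zero; suc; toℕ; fromℕ<)
import Data.Fin.Properties as Finₚ
open import Algebra.Properties.CommutativeMonoid.Sum ℤₚ.+-0-commutativeMonoid using (sum; sum-remove; ∑-distrib-+)
open import Data.Bool using (Bool; true; false; not; _xor_; _∧_; if_then_else_)
open import Data.Bool.Properties using (not-involutive; xor-identityʳ; xor-assoc; xor-same; not-distribˡ-xor)
open import Data.Product using (∃; _×_; _,_)
open import Data.Sum using (_⊎_; inj₁; inj₂; [_,_]′)
open import Data.Empty using (⊥; ⊥-elim)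
open import Function using (_∘_)
open import Function.Definitions using (Injective)
open import Relation.Binary.PropositionalEquality
open import Relation.Binary using (tri<; tri≈; tri>)
open import Relation.Nullary using (¬_; does; yes; no)
open import Relation.Nullary.Decidable using (dec-true; dec-false)

Σ< : ℕ → (ℕ → ℤ) → ℤ
Σ< k f = Σℤ k (λ j → f (toℕ j))

Σℤ-cong : ∀ k {f g : Fin k → ℤ} → (∀ j → f j ≡ g j) → Σℤ k f ≡ Σℤ k g
Σℤ-cong zero    f≗g = refl
Σℤ-cong (suc k) f≗g = cong₂ _⊕_ (f≗g zero) (Σℤ-cong k (f≗g ∘ suc))

Σℕ-cong : ∀ k {f g : Fin k → ℕ} → (∀ j → f j ≡ g j) → Σℕ k f ≡ Σℕ k g
Σℕ-cong zero    f≗g = refl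
Σℕ-cong (suc k) f≗g = cong₂ _+_ (f≗g zero) (Σℕ-cong k (f≗g ∘ suc))

Σ<-cong : ∀ k {f g : ℕ → ℤ} → (∀ r → r < k → f r ≡ g r) → Σ< k f ≡ Σ< k g
Σ<-cong zero    f≗g = refl
Σ<-cong (suc k) f≗g = cong₂ _⊕_ (f≗g 0 (s≤s z≤n)) (Σ<-cong k (λ r r<k → f≗g (suc r) (s≤s r<k)))

Σ<-suc : ∀ k f → Σ< (suc k) f ≡ Σ< k f ⊕ f k
Σ<-suc zero    f = trans (ℤₚ.+-identityʳ (f 0)) (sym (ℤₚ.+-identityˡ (f 0)))
Σ<-suc (suc k) f = trans (cong (f 0 ⊕_) (Σ<-suc k (f ∘ suc))) (sym (ℤₚ.+-assoc (f 0) _ _))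

Σ<-+ : ∀ m n f → Σ< (m + n) f ≡ Σ< m f ⊕ Σ< n (λ r → f (m + r))
Σ<-+ zero    n f = sym (ℤₚ.+-identityˡ _)
Σ<-+ (suc m) n f = trans (cong (f 0 ⊕_) (Σ<-+ m n (f ∘ suc))) (sym (ℤₚ.+-assoc (f 0) _ _))

Σ<-ends : ∀ m q f {A B C D} → Σ< m f ≡ A → Σ< q (λ r → f (m + r)) ≡ B → f (m + q) ≡ C → f (m + suc q) ≡ D →
          Σ< (m + suc (suc q)) f ≡ A ⊕ ((B ⊕ C) ⊕ D)
Σ<-ends m q f refl refl refl refl =
  trans (Σ<-+ m (suc (suc q)) f)
        (cong (Σ< m f ⊕_) (trans (Σ<-suc (suc q) g) (cong (_⊕ g (suc q)) (Σ<-suc q g))))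
  where g = λ r → f (m + r)

Σ<2-≡ : ∀ (f : ℕ → ℤ) {w x} → f 0 ≡ w → f 1 ≡ x → Σ< 2 f ≡ w ⊕ (x ⊕ + 0)
Σ<2-≡ f refl refl = refl

Σ<4-≡ : ∀ (f : ℕ → ℤ) {w x y z} → f 0 ≡ w → f 1 ≡ x → f 2 ≡ y → f 3 ≡ z → Σ< 4 f ≡ w ⊕ (x ⊕ (y ⊕ (z ⊕ + 0)))
Σ<4-≡ f refl refl refl refl = refl

Σℤ-zero : ∀ k → Σℤ k (λ _ → + 0) ≡ + 0
Σℤ-zero zero    = refl
Σℤ-zero (suc k) = trans (ℤₚ.+-identityˡ _) (Σℤ-zero k)

Σℕ-zero : ∀ k → Σℕ k (λ _ → 0) ≡ 0
Σℕ-zero zero    = refl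
Σℕ-zero (suc k) = Σℕ-zero k

Σℤ-neg : ∀ k f → Σℤ k (λ j → - f j) ≡ - Σℤ k f
Σℤ-neg zero    f = refl
Σℤ-neg (suc k) f = trans (cong (- f zero ⊕_) (Σℤ-neg k (f ∘ suc))) (sym (ℤₚ.neg-distrib-+ (f zero) _))

Σℤ≡sum : ∀ k f → Σℤ k f ≡ sum f
Σℤ≡sum zero    f = refl
Σℤ≡sum (suc k) f = cong (f zero ⊕_) (Σℤ≡sum k (f ∘ suc))

Σℤ-+ : ∀ k f g → Σℤ k (λ j → f j ⊕ g j) ≡ Σℤ k f ⊕ Σℤ k g
Σℤ-+ k f g = begin
  Σℤ k (λ j → f j ⊕ g j) ≡⟨ Σℤ≡sum k _ ⟩
  sum (λ j → f j ⊕ g j)  ≡⟨ ∑-distrib-+ f g ⟩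
  sum f ⊕ sum g          ≡⟨ sym (cong₂ _⊕_ (Σℤ≡sum k f) (Σℤ≡sum k g)) ⟩
  Σℤ k f ⊕ Σℤ k g        ∎
  where open ≡-Reasoning

isFirst : ∀ {k} → Fin k → Bool
isFirst zero    = true
isFirst (suc _) = false

Σℤ-first : ∀ k → 1 ≤ k → (F : Fin k → ℤ) → ∀ {x} → (∀ j → isFirst j ≡ true → F j ≡ x) →
           Σℤ k (λ j → if isFirst j then F j else + 0) ≡ x
Σℤ-first (suc k) _ F F≡x = trans (cong (F zero ⊕_) (Σℤ-zero k)) (trans (ℤₚ.+-identityʳ _) (F≡x zero refl))

Σℕ-first : ∀ k → 1 ≤ k → (F : Fin k → ℕ) → ∀ {x} → (∀ j → isFirst j ≡ true → F j ≡ x) →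
           Σℕ k (λ j → if isFirst j then F j else 0) ≡ x
Σℕ-first (suc k) _ F F≡x = trans (cong (_+_ (F zero)) (Σℕ-zero k)) (trans (ℕₚ.+-identityʳ _) (F≡x zero refl))

signed : Bool → ℕ → ℤ
signed true  l = + l
signed false l = - + l

signed-1+ : ∀ s l → signed s (1 + l) ≡ signed s 1 ⊕ signed s (0 + l)
signed-1+ true  l = refl
signed-1+ false l = ℤₚ.neg-distrib-+ (+ 1) (+ l)

signed-not : ∀ s l → signed (not s) l ≡ - signed s l
signed-not true  l = refl
signed-not false l = sym (ℤₚ.neg-involutive (+ l))

oneIf : Bool → ℕ
oneIf true  = 1
oneIf false = 0

Σsigned-1 : ∀ k (o : Fin k → Bool) →
            Σℤ k (λ j → signed (o j) 1) ≡ + Σℕ k (λ j → oneIf (o j)) - + Σℕ k (λ j → oneIf (not (o j)))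
Σsigned-1 zero    o = refl
Σsigned-1 (suc k) o with o zero | Σsigned-1 k (o ∘ suc)
... | true  | ih = trans (cong (+ 1 ⊕_) ih) (lemma (+ Σℕ k (oneIf ∘ o ∘ suc)) (+ Σℕ k (oneIf ∘ not ∘ o ∘ suc)))
  where lemma : ∀ X Y → + 1 ⊕ (X - Y) ≡ (+ 1 ⊕ X) - (+ 0 ⊕ Y)
        lemma = solve-∀
... | false | ih = trans (cong (- + 1 ⊕_) ih) (lemma (+ Σℕ k (oneIf ∘ o ∘ suc)) (+ Σℕ k (oneIf ∘ not ∘ o ∘ suc)))
  where lemma : ∀ X Y → - + 1 ⊕ (X - Y) ≡ (+ 0 ⊕ X) - (+ 1 ⊕ Y)
        lemma = solve-∀

in≡out : ∀ k (o : Fin k → Bool) → Σℤ k (λ j → signed (o j) 1) ≡ + 0 →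
         Σℕ k (λ j → oneIf (o j)) ≡ Σℕ k (λ j → oneIf (not (o j)))
in≡out k o Σ≡0 = ℤₚ.+-injective (ℤₚ.i-j≡0⇒i≡j _ _ (trans (sym (Σsigned-1 k o)) Σ≡0))

injective⇒onto : ∀ m (f : Fin m → Fin m) → Injective _≡_ _≡_ f → ∀ y → ∃ λ x → f x ≡ y
injective⇒onto (suc m) f f-inj y with Finₚ.any? (λ x → f x Fin.≟ y)
... | yes hit = hit
... | no miss = ⊥-elim (ℕₚ.<-irrefl refl (Finₚ.injective⇒≤ {f = g} g-inj))
  where
  y≢f : ∀ x → y ≢ f x
  y≢f x y≡fx = miss (x , sym y≡fx)
  g : Fin (suc m) → Fin m
  g x = Fin.punchOut (y≢f x)
  g-inj : Injective _≡_ _≡_ g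
  g-inj eq = f-inj (Finₚ.punchOut-injective (y≢f _) (y≢f _) eq)

sucEdge : ∀ {p} {n : Fin (suc p) → ℕ} → Snowflake.Edge p (n ∘ suc) → Snowflake.Edge (suc p) n
sucEdge (i , j) = suc i , j

sucEdge-injective : ∀ {p} {n : Fin (suc p) → ℕ} → Injective _≡_ _≡_ (sucEdge {n = n})
sucEdge-injective {x = i , j} {i' , j'} refl = refl

enumerate : ∀ p (n : Fin p → ℕ) → Fin (Σℕ p n) → Snowflake.Edge p n
enumerate (suc p) n = [ zero ,_ , sucEdge ∘ enumerate p (n ∘ suc) ]′ ∘ Fin.splitAt (n zero)

enumerate-injective : ∀ p (n : Fin p → ℕ) → Injective _≡_ _≡_ (enumerate p n)
enumerate-injective (suc p) n {x} {x'} eq = begin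
  x                     ≡⟨ sym (Finₚ.join-splitAt (n zero) _ x) ⟩
  join (splitAt x)      ≡⟨ cong join (cases (splitAt x) (splitAt x') eq) ⟩
  join (splitAt x')     ≡⟨ Finₚ.join-splitAt (n zero) _ x' ⟩
  x'                    ∎
  where
  open ≡-Reasoning
  rest = enumerate p (n ∘ suc)
  splitAt = Fin.splitAt (n zero) {Σℕ p (n ∘ suc)}
  join = Fin.join (n zero) (Σℕ p (n ∘ suc))
  cases : ∀ s s' → [ zero ,_ , sucEdge ∘ rest ]′ s ≡ [ zero ,_ , sucEdge ∘ rest ]′ s' → s ≡ s'
  cases (inj₁ j) (inj₁ j') refl = refl
  cases (inj₁ j) (inj₂ y') eq with rest y'
  cases (inj₁ j) (inj₂ y') () | _ , _
  cases (inj₂ y) (inj₁ j') eq with rest y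
  cases (inj₂ y) (inj₁ j') () | _ , _
  cases (inj₂ y) (inj₂ y') eq = cong inj₂ (enumerate-injective p (n ∘ suc) (sucEdge-injective {n = n} eq))

onto-by-counting : ∀ {A : Set} M (enum : Fin M → A) → Injective _≡_ _≡_ enum →
                   (φ : A → ℕ) → Injective _≡_ _≡_ φ → (S : ℕ → Set) → (∀ e → S (φ e)) →
                   (code : ℕ → ℕ) → (∀ l → S l → code l < M) →
                   (∀ {l l'} → S l → S l' → code l ≡ code l' → l ≡ l') →
                   ∀ l → S l → ∃ λ e → φ e ≡ l
onto-by-counting M enum enum-inj φ φ-inj S φ∈S code code<M code-inj l l∈S
  with injective⇒onto M f f-inj (fromℕ< (code<M l l∈S))
  where
  f : Fin M → Fin M
  f x = fromℕ< (code<M _ (φ∈S (enum x)))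
  f-inj : Injective _≡_ _≡_ f
  f-inj {x} {y} eq = enum-inj (φ-inj (code-inj (φ∈S (enum x)) (φ∈S (enum y))
    (trans (sym (Finₚ.toℕ-fromℕ< _)) (trans (cong toℕ eq) (Finₚ.toℕ-fromℕ< _)))))
... | x , fx≡l = enum x , code-inj (φ∈S (enum x)) l∈S
    (trans (sym (Finₚ.toℕ-fromℕ< _)) (trans (cong toℕ fx≡l) (Finₚ.toℕ-fromℕ< _)))

-- Whether m ≡ 2 (mod 4); meaningful for even m only.
twoMod4 : ℕ → Bool
twoMod4 zero          = false
twoMod4 (suc zero)    = false
twoMod4 (suc (suc m)) = not (twoMod4 m)

data EvenView : ℕ → Set where
  even0  : EvenView 0
  even+2 : ∀ {m} → EvenView m → EvenView (2 + m)

evenView : ∀ m → Even m → EvenView m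
evenView m (divides q refl) = go q
  where
  go : ∀ q → EvenView (q * 2)
  go zero    = even0
  go (suc q) = even+2 (go q)

evenView-+ : ∀ {a b} → EvenView a → EvenView b → EvenView (a + b)
evenView-+ even0      eb = eb
evenView-+ (even+2 ea) eb = even+2 (evenView-+ ea eb)

twoMod4-+ : ∀ {a} → EvenView a → ∀ b → twoMod4 (a + b) ≡ twoMod4 a xor twoMod4 b
twoMod4-+ even0      b = refl
twoMod4-+ (even+2 {a} ea) b = trans (cong not (twoMod4-+ ea b)) (not-distribˡ-xor (twoMod4 a) (twoMod4 b))

[4+m]%4≡m%4 : ∀ m → (4 + m) % 4 ≡ m % 4
[4+m]%4≡m%4 m = trans (cong (_% 4) (ℕₚ.+-comm 4 m)) ([m+n]%n≡m%n m 4)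

twoMod4-%4 : ∀ {m} → EvenView m → (twoMod4 m ≡ false × m % 4 ≡ 0) ⊎ (twoMod4 m ≡ true × m % 4 ≡ 2)
twoMod4-%4 even0                   = inj₁ (refl , refl)
twoMod4-%4 (even+2 even0)          = inj₂ (refl , refl)
twoMod4-%4 (even+2 (even+2 {m} e)) with twoMod4-%4 e
... | inj₁ (two , rem) = inj₁ (trans (not-involutive (twoMod4 m)) two , trans ([4+m]%4≡m%4 m) rem)
... | inj₂ (two , rem) = inj₂ (trans (not-involutive (twoMod4 m)) two , trans ([4+m]%4≡m%4 m) rem)

evenView-u*4 : ∀ u → EvenView (u * 4)
evenView-u*4 zero    = even0
evenView-u*4 (suc u) = even+2 (even+2 (evenView-u*4 u))

twoMod4-u*4 : ∀ u → twoMod4 (u * 4) ≡ false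
twoMod4-u*4 zero = refl
twoMod4-u*4 (suc u) rewrite twoMod4-u*4 u = refl

EvenView-unique : ∀ {m} (e e' : EvenView m) → e ≡ e'
EvenView-unique even0      even0       = refl
EvenView-unique (even+2 e) (even+2 e') = cong even+2 (EvenView-unique e e')

data StarSize : ℕ → Set where
  ≡0mod4 : ∀ u → StarSize (4 + u * 4)
  ≡2mod4 : ∀ u → StarSize (6 + u * 4)

4+_ : ∀ {k} → StarSize k → StarSize (4 + k)
4+ ≡0mod4 u = ≡0mod4 (suc u)
4+ ≡2mod4 u = ≡2mod4 (suc u)

starSize : ∀ k → Even k → 3 ≤ k → StarSize k
starSize k (divides (suc (suc q)) refl) _ = go q
  where
  go : ∀ q → StarSize (4 + q * 2)
  go zero          = ≡0mod4 0
  go (suc zero)    = ≡2mod4 0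
  go (suc (suc q)) = 4+ go q
starSize k (divides 1 refl) (s≤s (s≤s ()))
starSize k (divides 0 refl) ()

StarSize⇒4≤ : ∀ {k} → StarSize k → 4 ≤ k
StarSize⇒4≤ (≡0mod4 u) = s≤s (s≤s (s≤s (s≤s z≤n)))
StarSize⇒4≤ (≡2mod4 u) = s≤s (s≤s (s≤s (s≤s z≤n)))

StarSize⇒2≤ : ∀ {k} → StarSize k → 2 ≤ k
StarSize⇒2≤ size = ℕₚ.≤-trans (s≤s (s≤s z≤n)) (StarSize⇒4≤ size)

StarSize⇒1≤ : ∀ {k} → StarSize k → 1 ≤ k
StarSize⇒1≤ size = ℕₚ.≤-trans (s≤s z≤n) (StarSize⇒4≤ size)

StarSize⇒EvenView : ∀ {k} → StarSize k → EvenView k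
StarSize⇒EvenView (≡0mod4 u) = even+2 (even+2 (evenView-u*4 u))
StarSize⇒EvenView (≡2mod4 u) = even+2 (even+2 (even+2 (evenView-u*4 u)))

twoMod4-0mod4 : ∀ u → twoMod4 (4 + u * 4) ≡ false
twoMod4-0mod4 u rewrite twoMod4-u*4 u = refl

twoMod4-2mod4 : ∀ u → twoMod4 (6 + u * 4) ≡ true
twoMod4-2mod4 u rewrite twoMod4-u*4 u = refl

Σℕ-EvenView : ∀ p (n : Fin p → ℕ) → (∀ i → StarSize (n i)) → EvenView (Σℕ p n)
Σℕ-EvenView zero    n sizes = even0
Σℕ-EvenView (suc p) n sizes = evenView-+ (StarSize⇒EvenView (sizes zero)) (Σℕ-EvenView p (n ∘ suc) (sizes ∘ suc))

Σℕ≡0⊎2≤Σℕ : ∀ p (n : Fin p → ℕ) → (∀ i → StarSize (n i)) → Σℕ p n ≡ 0 ⊎ 2 ≤ Σℕ p n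
Σℕ≡0⊎2≤Σℕ zero    n sizes = inj₁ refl
Σℕ≡0⊎2≤Σℕ (suc p) n sizes = inj₂ (ℕₚ.≤-trans (StarSize⇒2≤ (sizes zero)) (ℕₚ.m≤m+n _ _))

1≤Σℕ : ∀ p (n : Fin p → ℕ) → 1 ≤ p → (∀ i → StarSize (n i)) → 1 ≤ Σℕ p n
1≤Σℕ (suc p) n _ sizes = ℕₚ.≤-trans (StarSize⇒1≤ (sizes zero)) (ℕₚ.m≤m+n _ _)

quadSign : ℕ → Bool
quadSign 0                         = true
quadSign 1                         = false
quadSign 2                         = false
quadSign 3                         = true
quadSign (suc (suc (suc (suc r)))) = quadSign r

quadSign-+u*4 : ∀ i u → quadSign (i + u * 4) ≡ quadSign i
quadSign-+u*4 i u = trans (cong quadSign (ℕₚ.+-comm i (u * 4))) (periodic u)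
  where
  periodic : ∀ u → quadSign (u * 4 + i) ≡ quadSign i
  periodic zero    = refl
  periodic (suc u) = periodic u

Σ<-4-periodic : ∀ (σ : ℕ → Bool) → (∀ r → σ (4 + r) ≡ σ r) →
                (∀ x → Σ< 4 (λ r → signed (σ r) (x + r)) ≡ + 0) →
                ∀ u x → Σ< (u * 4) (λ r → signed (σ r) (x + r)) ≡ + 0
Σ<-4-periodic σ σ-periodic quad≡0 zero    x = refl
Σ<-4-periodic σ σ-periodic quad≡0 (suc u) x = begin
  Σ< (4 + u * 4) (λ r → signed (σ r) (x + r))
    ≡⟨ Σ<-+ 4 (u * 4) (λ r → signed (σ r) (x + r)) ⟩
  Σ< 4 (λ r → signed (σ r) (x + r)) ⊕ Σ< (u * 4) (λ r → signed (σ (4 + r)) (x + (4 + r)))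
    ≡⟨ cong₂ _⊕_ (quad≡0 x) (Σ<-cong (u * 4) (λ r _ → cong₂ signed (σ-periodic r) (sym (ℕₚ.+-assoc x 4 r)))) ⟩
  + 0 ⊕ Σ< (u * 4) (λ r → signed (σ r) (x + 4 + r))
    ≡⟨ ℤₚ.+-identityˡ _ ⟩
  Σ< (u * 4) (λ r → signed (σ r) (x + 4 + r))
    ≡⟨ Σ<-4-periodic σ σ-periodic quad≡0 u (x + 4) ⟩
  + 0 ∎
  where open ≡-Reasoning

quadSign-Σ : ∀ u x → Σ< (u * 4) (λ r → signed (quadSign r) (x + r)) ≡ + 0
quadSign-Σ = Σ<-4-periodic quadSign (λ _ → refl) (λ x → lemma (+ x))
  where lemma : ∀ X → (X ⊕ + 0) ⊕ (- (X ⊕ + 1) ⊕ (- (X ⊕ + 2) ⊕ ((X ⊕ + 3) ⊕ + 0))) ≡ + 0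
        lemma = solve-∀

quadSign-shifted-Σ : ∀ u x → Σ< (u * 4) (λ r → signed (quadSign (2 + r)) (x + r)) ≡ + 0
quadSign-shifted-Σ = Σ<-4-periodic (λ r → quadSign (2 + r)) (λ _ → refl) (λ x → lemma (+ x))
  where lemma : ∀ X → - (X ⊕ + 0) ⊕ ((X ⊕ + 1) ⊕ ((X ⊕ + 2) ⊕ (- (X ⊕ + 3) ⊕ + 0))) ≡ + 0
        lemma = solve-∀

<ᵇ-true : ∀ {m n} → m < n → (m <ᵇ n) ≡ true
<ᵇ-true {zero}  (s≤s _)   = refl
<ᵇ-true {suc m} (s≤s m<n) = <ᵇ-true m<n

<ᵇ-false : ∀ {m n} → n ≤ m → (m <ᵇ n) ≡ false
<ᵇ-false {n = zero}      z≤n       = refl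
<ᵇ-false {suc m} {suc n} (s≤s n≤m) = <ᵇ-false n≤m

bumpLast : ℕ → Bool → ℕ → ℕ
bumpLast k cr r = if cr ∧ does (suc r ℕₚ.≟ k) then suc k else suc r

bumpLast-≢ : ∀ k cr r → suc r ≢ k → bumpLast k cr r ≡ suc r
bumpLast-≢ k cr r ≢k rewrite dec-false (suc r ℕₚ.≟ k) ≢k with cr
... | true  = refl
... | false = refl

bumpLast-≡ : ∀ k cr r → suc r ≡ k → bumpLast k cr r ≡ (if cr then suc k else k)
bumpLast-≡ k cr r ≡k rewrite dec-true (suc r ℕₚ.≟ k) ≡k with cr
... | true  = refl
... | false = ≡k

bumpLast-≥ : ∀ k cr r → r < k → suc r ≤ bumpLast k cr r
bumpLast-≥ k cr r r<k with suc r ℕₚ.≟ k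
... | no  ≢k = ℕₚ.≤-reflexive (sym (bumpLast-≢ k cr r ≢k))
... | yes ≡k rewrite bumpLast-≡ k cr r ≡k with cr
...   | true  = s≤s (ℕₚ.<⇒≤ r<k)
...   | false = ℕₚ.≤-reflexive ≡k

-- The edge of rank r of a star with k edges and block base a gets the label
-- a + offset k cl cr r: these are a+1, …, a+k, except that a carry-in cl gives
-- rank 0 the label a and a carry-out cr gives rank k−1 the label a+k+1.
offset : ℕ → Bool → Bool → ℕ → ℕ
offset k cl cr zero    = if cl then 0 else bumpLast k cr 0
offset k cl cr (suc r) = bumpLast k cr (suc r)

-- When k ≡ 2 (mod 4), exactly one end of the block carries; the pair of signs
-- at the other end is flipped.
starSign : ℕ → Bool → ℕ → Bool
starSign k cl r = quadSign r xor (twoMod4 k ∧ (if cl then k ≤ᵇ 2 + r else r <ᵇ 2))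

starTerm : ℕ → Bool → Bool → ℕ → ℕ → ℤ
starTerm k cl cr a r = signed (starSign k cl r) (a + offset k cl cr r)

starSign-0mod4 : ∀ u cl r → starSign (4 + u * 4) cl r ≡ quadSign r
starSign-0mod4 u cl r rewrite twoMod4-0mod4 u = xor-identityʳ (quadSign r)

starSign-2mod4 : ∀ u cl r →
  starSign (6 + u * 4) cl r ≡ quadSign r xor (if cl then 6 + u * 4 ≤ᵇ 2 + r else r <ᵇ 2)
starSign-2mod4 u cl r rewrite twoMod4-2mod4 u = refl

Σ-star-0mod4 : ∀ u a → Σ< (4 + u * 4) (starTerm (4 + u * 4) false false a) ≡ + 0
Σ-star-0mod4 u a =
  trans (Σ<-cong (4 + u * 4) (λ r _ → cong₂ signed (starSign-0mod4 u false r) (ℕₚ.+-suc a r)))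
        (quadSign-Σ (suc u) (suc a))

Σ-star-0mod4-carried : ∀ u a → Σ< (4 + u * 4) (starTerm (4 + u * 4) true true a) ≡ + 0
Σ-star-0mod4-carried u a =
  trans (Σ<-ends 2 q T (Σ<2-≡ T T0 T1) middle T2+q T3+q) (lemma (+ a) (+ q))
  where
  q = u * 4
  k = 4 + q
  T = starTerm k true true a
  sign = starSign-0mod4 u true
  T0 : T 0 ≡ + (a + 0)
  T0 = cong₂ signed (sign 0) refl
  T1 : T 1 ≡ - + (a + 2)
  T1 = cong₂ signed (sign 1) (cong (_+_ a) (bumpLast-≢ k true 1 (λ ())))
  middle : Σ< q (λ r → T (2 + r)) ≡ + 0
  middle = trans (Σ<-cong q (λ r r<q → cong₂ signed (sign (2 + r))
                   (trans (cong (_+_ a) (bumpLast-≢ k true (2 + r) (ℕₚ.<⇒≢ (ℕₚ.+-monoʳ-< 3 (ℕₚ.m<n⇒m<1+n r<q)))))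
                          (sym (ℕₚ.+-assoc a 3 r)))))
                 (quadSign-shifted-Σ u (a + 3))
  T2+q : T (2 + q) ≡ - + (a + (3 + q))
  T2+q = cong₂ signed (trans (sign (2 + q)) (quadSign-+u*4 2 u))
                      (cong (_+_ a) (bumpLast-≢ k true (2 + q) (ℕₚ.<⇒≢ (ℕₚ.n<1+n (3 + q)))))
  T3+q : T (3 + q) ≡ + (a + (5 + q))
  T3+q = cong₂ signed (trans (sign (3 + q)) (quadSign-+u*4 3 u)) (cong (_+_ a) (bumpLast-≡ k true (3 + q) refl))
  lemma : ∀ A Q → ((A ⊕ + 0) ⊕ (- (A ⊕ + 2) ⊕ + 0)) ⊕ ((+ 0 ⊕ - (A ⊕ (+ 3 ⊕ Q))) ⊕ (A ⊕ (+ 5 ⊕ Q))) ≡ + 0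
  lemma = solve-∀

Σ-star-2mod4-carryIn : ∀ u a → Σ< (6 + u * 4) (starTerm (6 + u * 4) true false a) ≡ + 0
Σ-star-2mod4-carryIn u a =
  trans (Σ<-ends 4 q T (Σ<4-≡ T T0 T1 T2 T3) middle T4+q T5+q) (lemma (+ a) (+ q))
  where
  q = u * 4
  k = 6 + q
  T = starTerm k true false a
  sign = starSign-2mod4 u true
  T0 : T 0 ≡ + (a + 0)
  T0 = cong₂ signed (sign 0) refl
  T1 : T 1 ≡ - + (a + 2)
  T1 = cong₂ signed (sign 1) refl
  T2 : T 2 ≡ - + (a + 3)
  T2 = cong₂ signed (sign 2) refl
  T3 : T 3 ≡ + (a + 4)
  T3 = cong₂ signed (sign 3) refl
  middle : Σ< q (λ r → T (4 + r)) ≡ + 0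
  middle = trans (Σ<-cong q (λ r r<q → cong₂ signed
                   (trans (sign (4 + r)) (trans (cong (quadSign r xor_) (<ᵇ-false r<q)) (xor-identityʳ (quadSign r))))
                   (sym (ℕₚ.+-assoc a 5 r))))
                 (quadSign-Σ u (a + 5))
  T4+q : T (4 + q) ≡ - + (a + (5 + q))
  T4+q = cong₂ signed (trans (sign (4 + q)) (cong₂ _xor_ (quadSign-+u*4 0 u) (<ᵇ-true (ℕₚ.n<1+n q)))) refl
  T5+q : T (5 + q) ≡ + (a + (6 + q))
  T5+q = cong₂ signed (trans (sign (5 + q)) (cong₂ _xor_ (quadSign-+u*4 1 u) (<ᵇ-true (ℕₚ.m<n⇒m<1+n (ℕₚ.n<1+n q))))) refl
  lemma : ∀ A Q → ((A ⊕ + 0) ⊕ (- (A ⊕ + 2) ⊕ (- (A ⊕ + 3) ⊕ ((A ⊕ + 4) ⊕ + 0)))) ⊕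
                  ((+ 0 ⊕ - (A ⊕ (+ 5 ⊕ Q))) ⊕ (A ⊕ (+ 6 ⊕ Q))) ≡ + 0
  lemma = solve-∀

Σ-star-2mod4-carryOut : ∀ u a → Σ< (6 + u * 4) (starTerm (6 + u * 4) false true a) ≡ + 0
Σ-star-2mod4-carryOut u a =
  trans (Σ<-ends 4 q T (Σ<4-≡ T T0 T1 T2 T3) middle T4+q T5+q) (lemma (+ a) (+ q))
  where
  q = u * 4
  k = 6 + q
  T = starTerm k false true a
  sign = starSign-2mod4 u false
  below : ∀ r → r < 4 → suc r ≢ k
  below r r<4 = ℕₚ.<⇒≢ (ℕₚ.≤-trans (s≤s (ℕₚ.m<n⇒m<1+n r<4)) (ℕₚ.m≤m+n 6 q))
  T0 : T 0 ≡ - + (a + 1)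
  T0 = cong₂ signed (sign 0) (cong (_+_ a) (bumpLast-≢ k true 0 (below 0 (s≤s z≤n))))
  T1 : T 1 ≡ + (a + 2)
  T1 = cong₂ signed (sign 1) (cong (_+_ a) (bumpLast-≢ k true 1 (below 1 (s≤s (s≤s z≤n)))))
  T2 : T 2 ≡ - + (a + 3)
  T2 = cong₂ signed (sign 2) (cong (_+_ a) (bumpLast-≢ k true 2 (below 2 (s≤s (s≤s (s≤s z≤n))))))
  T3 : T 3 ≡ + (a + 4)
  T3 = cong₂ signed (sign 3) (cong (_+_ a) (bumpLast-≢ k true 3 (below 3 ℕₚ.≤-refl)))
  middle : Σ< q (λ r → T (4 + r)) ≡ + 0
  middle = trans (Σ<-cong q (λ r r<q → cong₂ signed
                   (trans (sign (4 + r)) (xor-identityʳ (quadSign r)))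
                   (trans (cong (_+_ a) (bumpLast-≢ k true (4 + r) (ℕₚ.<⇒≢ (ℕₚ.+-monoʳ-< 5 (ℕₚ.m<n⇒m<1+n r<q)))))
                          (sym (ℕₚ.+-assoc a 5 r)))))
                 (quadSign-Σ u (a + 5))
  T4+q : T (4 + q) ≡ + (a + (5 + q))
  T4+q = cong₂ signed (trans (sign (4 + q)) (trans (xor-identityʳ _) (quadSign-+u*4 0 u)))
                      (cong (_+_ a) (bumpLast-≢ k true (4 + q) (ℕₚ.<⇒≢ (ℕₚ.n<1+n (5 + q)))))
  T5+q : T (5 + q) ≡ - + (a + (7 + q))
  T5+q = cong₂ signed (trans (sign (5 + q)) (trans (xor-identityʳ _) (quadSign-+u*4 1 u)))
                      (cong (_+_ a) (bumpLast-≡ k true (5 + q) refl))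
  lemma : ∀ A Q → (- (A ⊕ + 1) ⊕ ((A ⊕ + 2) ⊕ (- (A ⊕ + 3) ⊕ ((A ⊕ + 4) ⊕ + 0)))) ⊕
                  ((+ 0 ⊕ (A ⊕ (+ 5 ⊕ Q))) ⊕ - (A ⊕ (+ 7 ⊕ Q))) ≡ + 0
  lemma = solve-∀

star-Σ≡0 : ∀ {k} → StarSize k → ∀ cl cr → twoMod4 k ≡ cl xor cr → ∀ a → Σ< k (starTerm k cl cr a) ≡ + 0
star-Σ≡0 (≡0mod4 u) false false _ = Σ-star-0mod4 u
star-Σ≡0 (≡0mod4 u) true  true  _ = Σ-star-0mod4-carried u
star-Σ≡0 (≡2mod4 u) true  false _ = Σ-star-2mod4-carryIn u
star-Σ≡0 (≡2mod4 u) false true  _ = Σ-star-2mod4-carryOut u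
star-Σ≡0 (≡0mod4 u) true  false t with () ← trans (sym (twoMod4-0mod4 u)) t
star-Σ≡0 (≡0mod4 u) false true  t with () ← trans (sym (twoMod4-0mod4 u)) t
star-Σ≡0 (≡2mod4 u) true  true  t with () ← trans (sym (twoMod4-2mod4 u)) t
star-Σ≡0 (≡2mod4 u) false false t with () ← trans (sym (twoMod4-2mod4 u)) t

-- The sign sum is the difference of the signed sums of the blocks based at 1 and at 0.
star-signs-Σ≡0 : ∀ {k} → StarSize k → ∀ cl cr → twoMod4 k ≡ cl xor cr →
                 Σ< k (λ r → signed (starSign k cl r) 1) ≡ + 0
star-signs-Σ≡0 {k} size cl cr carries = begin
  Σ< k ones                                       ≡⟨ sym (ℤₚ.+-identityʳ _) ⟩
  Σ< k ones ⊕ + 0                                 ≡⟨ cong (Σ< k ones ⊕_) (sym (star-Σ≡0 size cl cr carries 0)) ⟩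
  Σ< k ones ⊕ Σ< k (starTerm k cl cr 0)           ≡⟨ sym (Σℤ-+ k _ _) ⟩
  Σ< k (λ r → ones r ⊕ starTerm k cl cr 0 r)      ≡⟨ sym (Σ<-cong k (λ r _ → signed-1+ (starSign k cl r) (offset k cl cr r))) ⟩
  Σ< k (starTerm k cl cr 1)                       ≡⟨ star-Σ≡0 size cl cr carries 1 ⟩
  + 0                                             ∎
  where
  open ≡-Reasoning
  ones = λ r → signed (starSign k cl r) 1

-- Edge 0 of a star is its edge to z; rank z gives it rank z.
rank : ∀ {k} → Fin k → Fin k → Fin k
rank z zero    = z
rank z (suc j) = Fin.punchIn z j

rank-injective : ∀ {k} (z : Fin k) → Injective _≡_ _≡_ (rank z)
rank-injective z {zero}  {zero}   _  = refl
rank-injective z {zero}  {suc j'} eq = ⊥-elim (Finₚ.punchInᵢ≢i z j' (sym eq))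
rank-injective z {suc j} {zero}   eq = ⊥-elim (Finₚ.punchInᵢ≢i z j eq)
rank-injective z {suc j} {suc j'} eq = cong suc (Finₚ.punchIn-injective z j j' eq)

Σℤ-rank : ∀ k f (z : Fin k) → Σℤ k (λ j → f (rank z j)) ≡ Σℤ k f
Σℤ-rank (suc k) f z = begin
  f z ⊕ Σℤ k (λ j → f (Fin.punchIn z j)) ≡⟨ cong (f z ⊕_) (Σℤ≡sum k _) ⟩
  f z ⊕ sum (λ j → f (Fin.punchIn z j))  ≡⟨ sym (sum-remove f) ⟩
  sum f                                   ≡⟨ sym (Σℤ≡sum (suc k) f) ⟩
  Σℤ (suc k) f                            ∎
  where open ≡-Reasoning

rotate-Σ≡0 : ∀ k (s : ℕ → Bool) (L : ℕ → ℕ) (z : Fin k) D → Σ< k (λ r → signed (s r) (L r)) ≡ + 0 →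
             Σℤ k (λ j → signed ((D xor s (toℕ z)) xor s (toℕ (rank z j))) (L (toℕ (rank z j)))) ≡ + 0
rotate-Σ≡0 k s L z D Σ≡0 = trans (Σℤ-rank k (λ j → signed (E xor s (toℕ j)) (L (toℕ j))) z) (flipped E)
  where
  E = D xor s (toℕ z)
  flipped : ∀ E → Σ< k (λ r → signed (E xor s r) (L r)) ≡ + 0
  flipped false = Σ≡0
  flipped true  = trans (Σ<-cong k (λ r _ → signed-not (s r) (L r))) (trans (Σℤ-neg k _) (cong -_ Σ≡0))

-- Negating all signs keeps a star balanced; it makes the z-edge point in direction D.
starOrientation : ∀ k → Bool → Fin k → Bool → Fin k → Bool
starOrientation k cl z D j = (D xor starSign k cl (toℕ z)) xor starSign k cl (toℕ (rank z j))

starLabel : ∀ k → Bool → Bool → Fin k → ℕ → Fin k → ℕ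
starLabel k cl cr z a j = a + offset k cl cr (toℕ (rank z j))

star-vertexSum≡0 : ∀ {k} → StarSize k → ∀ cl cr → twoMod4 k ≡ cl xor cr → ∀ z D a →
                   Σℤ k (λ j → signed (starOrientation k cl z D j) (starLabel k cl cr z a j)) ≡ + 0
star-vertexSum≡0 {k} size cl cr carries z D a =
  rotate-Σ≡0 k (starSign k cl) (λ r → a + offset k cl cr r) z D (star-Σ≡0 size cl cr carries a)

star-in≡out : ∀ {k} → StarSize k → ∀ cl cr → twoMod4 k ≡ cl xor cr → ∀ z D →
              Σℕ k (λ j → oneIf (starOrientation k cl z D j)) ≡ Σℕ k (λ j → oneIf (not (starOrientation k cl z D j)))
star-in≡out {k} size cl cr carries z D =
  in≡out k _ (rotate-Σ≡0 k (starSign k cl) (λ _ → 1) z D (star-signs-Σ≡0 size cl cr carries))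

starOrientation-first : ∀ k cl z D (j : Fin k) → isFirst j ≡ true → starOrientation k cl z D j ≡ D
starOrientation-first k cl z D zero _ = begin
  (D xor s) xor s ≡⟨ xor-assoc D s s ⟩
  D xor (s xor s) ≡⟨ cong (D xor_) (xor-same s) ⟩
  D xor false     ≡⟨ xor-identityʳ D ⟩
  D               ∎
  where
  open ≡-Reasoning
  s = starSign k cl (toℕ z)

starLabel-first : ∀ k cl cr z a (j : Fin k) → isFirst j ≡ true → starLabel k cl cr z a j ≡ a + offset k cl cr (toℕ z)
starLabel-first k cl cr z a zero _ = refl

star-zTerm : ∀ k → 1 ≤ k → ∀ cl cr z D a →
  Σℤ k (λ j → if isFirst j then signed (not (starOrientation k cl z D j)) (starLabel k cl cr z a j) else + 0)
  ≡ signed (not D) (a + offset k cl cr (toℕ z))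
star-zTerm k 1≤k cl cr z D a = Σℤ-first k 1≤k _ (λ j first →
  cong₂ signed (cong not (starOrientation-first k cl z D j first)) (starLabel-first k cl cr z a j first))

star-zDegree : ∀ k → 1 ≤ k → ∀ cl z D (B : Bool → ℕ) →
  Σℕ k (λ j → if isFirst j then B (starOrientation k cl z D j) else 0) ≡ B D
star-zDegree k 1≤k cl z D B = Σℕ-first k 1≤k _ (λ j first → cong B (starOrientation-first k cl z D j first))

offset-≤ : ∀ k cl cr r → suc r < k → offset k cl cr r ≤ suc r
offset-≤ k true  cr zero    _   = z≤n
offset-≤ k false cr zero    1<k = ℕₚ.≤-reflexive (bumpLast-≢ k cr 0 (ℕₚ.<⇒≢ 1<k))
offset-≤ k cl    cr (suc r) r<k = ℕₚ.≤-reflexive (bumpLast-≢ k cr (suc r) (ℕₚ.<⇒≢ r<k))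

offset-< : ∀ k cl cr r r' → r < r' → r' < k → offset k cl cr r < offset k cl cr r'
offset-< k cl cr r (suc r') r<r' r'<k =
  ℕₚ.≤-<-trans (offset-≤ k cl cr r (ℕₚ.≤-<-trans r<r' r'<k)) (ℕₚ.<-≤-trans (s≤s r<r') (bumpLast-≥ k cr (suc r') r'<k))

offset-injective : ∀ k cl cr r r' → r < k → r' < k → offset k cl cr r ≡ offset k cl cr r' → r ≡ r'
offset-injective k cl cr r r' r<k r'<k eq with ℕₚ.<-cmp r r'
... | tri< r<r' _ _ = ⊥-elim (ℕₚ.<-irrefl eq (offset-< k cl cr r r' r<r' r'<k))
... | tri≈ _ r≡r' _ = r≡r'
... | tri> _ _ r>r' = ⊥-elim (ℕₚ.<-irrefl (sym eq) (offset-< k cl cr r' r r>r' r<k))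

starLabel-injective : ∀ k cl cr (z : Fin k) a → Injective _≡_ _≡_ (starLabel k cl cr z a)
starLabel-injective k cl cr z a {j} {j'} eq =
  rank-injective z (Finₚ.toℕ-injective (offset-injective k cl cr _ _ (Finₚ.toℕ<n _) (Finₚ.toℕ<n _)
    (ℕₚ.+-cancelˡ-≡ a _ _ eq)))

InBlock : ℕ → Bool → ℕ → Bool → ℕ → Set
InBlock a cl N cr l = (suc a ≤ l ⊎ (cl ≡ true × l ≡ a))
                    × (l ≤ a + N ⊎ (cr ≡ true × l ≡ suc (a + N)))
                    × (cl ≡ true → l ≢ suc a)
                    × (cr ≡ true → l ≢ a + N)

InBlock-shift : ∀ a {cl N cr l} → InBlock 0 cl N cr l → InBlock a cl N cr (a + l)
InBlock-shift a {l = l} (lo , hi , ≢first , ≢last) =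
  [ (λ 1≤l → inj₁ (ℕₚ.≤-trans (ℕₚ.≤-reflexive (ℕₚ.+-comm 1 a)) (ℕₚ.+-monoʳ-≤ a 1≤l))) ,
    (λ { (c , refl) → inj₂ (c , ℕₚ.+-identityʳ a) }) ]′ lo ,
  [ (λ l≤N → inj₁ (ℕₚ.+-monoʳ-≤ a l≤N)) , (λ { (c , refl) → inj₂ (c , ℕₚ.+-suc a _) }) ]′ hi ,
  (λ c eq → ≢first c (ℕₚ.+-cancelˡ-≡ a l 1 (trans eq (ℕₚ.+-comm 1 a)))) ,
  (λ c eq → ≢last c (ℕₚ.+-cancelˡ-≡ a _ _ eq))

offset-InBlock₀ : ∀ k cl cr r → 2 ≤ k → r < k → InBlock 0 cl k cr (offset k cl cr r)
offset-InBlock₀ k true  cr zero 2≤k _ =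
  inj₂ (refl , refl) , inj₁ z≤n , (λ _ ()) , (λ _ → ℕₚ.<⇒≢ (ℕₚ.≤-trans (s≤s z≤n) 2≤k))
offset-InBlock₀ k false cr zero 2≤k _ rewrite bumpLast-≢ k cr 0 (ℕₚ.<⇒≢ 2≤k) =
  inj₁ ℕₚ.≤-refl , inj₁ (ℕₚ.≤-trans (s≤s z≤n) 2≤k) , (λ ()) , (λ _ → ℕₚ.<⇒≢ 2≤k)
offset-InBlock₀ k cl cr (suc r) 2≤k r<k with suc (suc r) ℕₚ.≟ k
... | no ≢k rewrite bumpLast-≢ k cr (suc r) ≢k = inj₁ (s≤s z≤n) , inj₁ r<k , (λ _ ()) , (λ _ → ≢k)
... | yes ≡k rewrite bumpLast-≡ k cr (suc r) ≡k with cr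
...   | true  = inj₁ (s≤s z≤n) , inj₂ (refl , refl) ,
                (λ _ eq → ℕₚ.<⇒≢ (s≤s (ℕₚ.≤-trans (s≤s z≤n) 2≤k)) (sym eq)) , (λ _ → ℕₚ.1+n≢n)
...   | false = inj₁ (ℕₚ.≤-trans (s≤s z≤n) 2≤k) , inj₁ ℕₚ.≤-refl ,
                (λ _ eq → ℕₚ.<⇒≢ 2≤k (sym eq)) , (λ ())

starLabel-InBlock : ∀ k cl cr (z : Fin k) a → 2 ≤ k → ∀ j → InBlock a cl k cr (starLabel k cl cr z a j)
starLabel-InBlock k cl cr z a 2≤k j = InBlock-shift a (offset-InBlock₀ k cl cr _ 2≤k (Finₚ.toℕ<n (rank z j)))

InBlock-extendʳ : ∀ {a cl N cr} N' cr' {l} → InBlock a cl N cr l → (N' ≡ 0 → cr' ≡ cr) → N' ≡ 0 ⊎ 2 ≤ N' →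
                  InBlock a cl (N + N') cr' l
InBlock-extendʳ {N = N} .0 cr' l∈ carry (inj₁ refl) rewrite ℕₚ.+-identityʳ N | carry refl = l∈
InBlock-extendʳ {a} {cl} {N} N' cr' {l} (lo , hi , ≢first , _) _ (inj₂ 2≤N') = lo , inj₁ l≤ , ≢first , ≢last
  where
  l≤suc : l ≤ suc (a + N)
  l≤suc = [ (λ l≤ → ℕₚ.≤-trans l≤ (ℕₚ.n≤1+n _)) , (λ { (_ , refl) → ℕₚ.≤-refl }) ]′ hi
  2+≤ : suc (suc (a + N)) ≤ a + (N + N')
  2+≤ = subst (_≤ a + (N + N')) (ℕₚ.+-comm (a + N) 2)
          (ℕₚ.≤-trans (ℕₚ.+-monoʳ-≤ (a + N) 2≤N') (ℕₚ.≤-reflexive (ℕₚ.+-assoc a N N')))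
  l≤ : l ≤ a + (N + N')
  l≤ = ℕₚ.≤-trans l≤suc (ℕₚ.≤-trans (ℕₚ.n≤1+n _) 2+≤)
  ≢last : cr' ≡ true → l ≢ a + (N + N')
  ≢last _ eq = ℕₚ.<-irrefl eq (ℕₚ.≤-<-trans l≤suc 2+≤)

InBlock-extendˡ : ∀ {a} cl {N cm N' cr l} → 2 ≤ N → InBlock (a + N) cm N' cr l → InBlock a cl (N + N') cr l
InBlock-extendˡ {a} cl {N} {cm} {N'} {cr} {l} 2≤N (lo , hi , _ , ≢last) = inj₁ lo' , hi' , ≢first , ≢last'
  where
  a+N≤l : a + N ≤ l
  a+N≤l = [ (λ le → ℕₚ.≤-trans (ℕₚ.n≤1+n _) le) , (λ { (_ , refl) → ℕₚ.≤-refl }) ]′ lo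
  2+a≤a+N : suc (suc a) ≤ a + N
  2+a≤a+N = subst (_≤ a + N) (ℕₚ.+-comm a 2) (ℕₚ.+-monoʳ-≤ a 2≤N)
  lo' : suc a ≤ l
  lo' = ℕₚ.≤-trans (ℕₚ.n≤1+n _) (ℕₚ.≤-trans 2+a≤a+N a+N≤l)
  hi' : l ≤ a + (N + N') ⊎ (cr ≡ true × l ≡ suc (a + (N + N')))
  hi' = [ (λ le → inj₁ (ℕₚ.≤-trans le (ℕₚ.≤-reflexive (ℕₚ.+-assoc a N N')))) ,
          (λ { (c , eq) → inj₂ (c , trans eq (cong suc (ℕₚ.+-assoc a N N'))) }) ]′ hi
  ≢first : cl ≡ true → l ≢ suc a
  ≢first _ eq = ℕₚ.<-irrefl (sym eq) (ℕₚ.≤-trans 2+a≤a+N a+N≤l)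
  ≢last' : cr ≡ true → l ≢ a + (N + N')
  ≢last' c eq = ≢last c (trans eq (sym (ℕₚ.+-assoc a N N')))

InBlock-disjoint : ∀ {a cl N cm N' cr l} → InBlock a cl N cm l → InBlock (a + N) cm N' cr l → ⊥
InBlock-disjoint (_ , hi , _ , ≢last) (lo , _ , ≢first , _) with hi | lo
... | inj₁ l≤  | inj₁ l>        = ℕₚ.<-irrefl refl (ℕₚ.<-≤-trans l> l≤)
... | inj₁ _   | inj₂ (c , eq)  = ≢last c eq
... | inj₂ (c , eq) | inj₁ _    = ≢first c eq
... | inj₂ (_ , eq) | inj₂ (_ , eq') = ℕₚ.1+n≢n (trans (sym eq) eq')

-- The z-edges of two consecutive stars get labels x and x + gap, with opposite
-- orientations, so that the pair contributes ± gap to the vertex-sum at z.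
data Pairing : Set where
  rise fall rise₂ : Pairing

gap : Pairing → ℕ
gap rise  = 1
gap fall  = 1
gap rise₂ = 2

zContribution : Pairing → ℤ
zContribution rise  = + 1
zContribution fall  = - + 1
zContribution rise₂ = + 2

zDirection : Pairing → Bool
zDirection fall = false
zDirection _    = true

-- Ranks of the two z-edges of a pair, near the top of the first block and the
-- bottom of the second, shifted past the labels exchanged by a carry c₁.
zRank₀ℕ : ℕ → Bool → Pairing → ℕ
zRank₀ℕ k true rise  = pred (pred k)
zRank₀ℕ k true fall  = pred (pred k)
zRank₀ℕ k _    _     = pred k

zRank₁ℕ : Bool → Pairing → ℕ
zRank₁ℕ c₁ rise₂ = suc (oneIf c₁)
zRank₁ℕ _  _     = 0

zLabel-gap : ∀ k₀ k₁ → 4 ≤ k₀ → 4 ≤ k₁ → ∀ c c₁ c₂ t a →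
             (a + k₀) + offset k₁ c₁ c₂ (zRank₁ℕ c₁ t) ≡ gap t + (a + offset k₀ c c₁ (zRank₀ℕ k₀ c₁ t))
zLabel-gap k₀@(suc (suc (suc (suc m)))) k₁ (s≤s (s≤s (s≤s (s≤s _)))) 4≤k₁ c c₁ c₂ t a = go c₁ t
  where
  ≢k₁ : ∀ r → r < 3 → suc r ≢ k₁
  ≢k₁ r r<3 = ℕₚ.<⇒≢ (ℕₚ.≤-trans (s≤s r<3) 4≤k₁)
  carried : a + k₀ + 0 ≡ 1 + (a + bumpLast k₀ true (2 + m))
  carried = trans (lemma a m) (cong (λ x → 1 + (a + x)) (sym (bumpLast-≢ k₀ true (2 + m) (ℕₚ.<⇒≢ (ℕₚ.n<1+n (3 + m))))))
    where lemma : ∀ a m → a + (4 + m) + 0 ≡ 1 + (a + (3 + m))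
          lemma = solve-∀ℕ
  go : ∀ c₁ t → (a + k₀) + offset k₁ c₁ c₂ (zRank₁ℕ c₁ t) ≡ gap t + (a + offset k₀ c c₁ (zRank₀ℕ k₀ c₁ t))
  go false rise  = trans (cong (_+_ (a + k₀)) (bumpLast-≢ k₁ c₂ 0 (≢k₁ 0 (s≤s z≤n)))) (ℕₚ.+-comm (a + k₀) 1)
  go false fall  = trans (cong (_+_ (a + k₀)) (bumpLast-≢ k₁ c₂ 0 (≢k₁ 0 (s≤s z≤n)))) (ℕₚ.+-comm (a + k₀) 1)
  go false rise₂ = trans (cong (_+_ (a + k₀)) (bumpLast-≢ k₁ c₂ 1 (≢k₁ 1 (s≤s (s≤s z≤n))))) (ℕₚ.+-comm (a + k₀) 2)
  go true  rise  = carried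
  go true  fall  = carried
  go true  rise₂ = begin
    a + k₀ + bumpLast k₁ c₂ 2           ≡⟨ cong (_+_ (a + k₀)) (bumpLast-≢ k₁ c₂ 2 (≢k₁ 2 (s≤s (s≤s (s≤s z≤n))))) ⟩
    a + (4 + m) + 3                     ≡⟨ lemma a m ⟩
    2 + (a + (5 + m))                   ≡⟨ cong (λ x → 2 + (a + x)) (sym (bumpLast-≡ k₀ true (3 + m) refl)) ⟩
    2 + (a + bumpLast k₀ true (3 + m))  ∎
    where
    open ≡-Reasoning
    lemma : ∀ a m → a + (4 + m) + 3 ≡ 2 + (a + (5 + m))
    lemma = solve-∀ℕ

pair-zSum : ∀ t x → signed (not (zDirection t)) x ⊕ signed (not (not (zDirection t))) (gap t + x) ≡ zContribution t
pair-zSum rise  x = lemma (+ x)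
  where lemma : ∀ X → - X ⊕ (+ 1 ⊕ X) ≡ + 1
        lemma = solve-∀
pair-zSum fall  x = lemma (+ x)
  where lemma : ∀ X → X ⊕ - (+ 1 ⊕ X) ≡ - + 1
        lemma = solve-∀
pair-zSum rise₂ x = lemma (+ x)
  where lemma : ∀ X → - X ⊕ (+ 2 ⊕ X) ≡ + 2
        lemma = solve-∀

zRank₀ : ∀ {k} → StarSize k → Bool → Pairing → Fin k
zRank₀ {k} size c₁ t = fromℕ< (bound k c₁ t (StarSize⇒4≤ size))
  where
  bound : ∀ k c₁ t → 4 ≤ k → zRank₀ℕ k c₁ t < k
  bound (suc (suc k)) true  rise  _        = ℕₚ.m<n⇒m<1+n (ℕₚ.n<1+n k)
  bound (suc (suc k)) true  fall  _        = ℕₚ.m<n⇒m<1+n (ℕₚ.n<1+n k)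
  bound (suc zero)    true  rise  (s≤s ())
  bound (suc zero)    true  fall  (s≤s ())
  bound (suc k)       true  rise₂ _        = ℕₚ.n<1+n k
  bound (suc k)       false t     _        = ℕₚ.n<1+n k

zRank₁ : ∀ {k} → StarSize k → Bool → Pairing → Fin k
zRank₁ {k} size c₁ t = fromℕ< (bound c₁ t)
  where
  4≤k = StarSize⇒4≤ size
  bound : ∀ c₁ t → zRank₁ℕ c₁ t < k
  bound true  rise₂ = ℕₚ.≤-trans (s≤s (s≤s (s≤s z≤n))) 4≤k
  bound false rise₂ = ℕₚ.≤-trans (s≤s (s≤s z≤n)) 4≤k
  bound _     rise  = ℕₚ.≤-trans (s≤s z≤n) 4≤k
  bound _     fall  = ℕₚ.≤-trans (s≤s z≤n) 4≤k

alternating : ℕ → Pairing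
alternating zero          = rise
alternating (suc zero)    = fall
alternating (suc (suc t)) = alternating t

-- An odd number of pairs cannot cancel with ±1 alone; start with +2 −1 −1.
withRise₂ : ℕ → Pairing
withRise₂ 0                   = rise₂
withRise₂ 1                   = fall
withRise₂ 2                   = fall
withRise₂ (suc (suc (suc t))) = alternating t

zPairings : ℕ → ℕ → Pairing
zPairings p = if twoMod4 p then withRise₂ else alternating

pairSum : ∀ {p} → EvenView p → (ℕ → Pairing) → ℤ
pairSum even0      t = + 0
pairSum (even+2 e) t = zContribution (t 0) ⊕ pairSum e (t ∘ suc)

pairSum-alternating : ∀ u → pairSum (evenView-u*4 u) alternating ≡ + 0
pairSum-alternating zero    = refl
pairSum-alternating (suc u) = cong (λ s → + 1 ⊕ (- + 1 ⊕ s)) (pairSum-alternating u)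

pairSum-zPairings : ∀ {p} → StarSize p → (e : EvenView p) → pairSum e (zPairings p) ≡ + 0
pairSum-zPairings (≡0mod4 u) e rewrite EvenView-unique e (StarSize⇒EvenView (≡0mod4 u)) | twoMod4-0mod4 u =
  cong (λ s → + 1 ⊕ (- + 1 ⊕ s)) (pairSum-alternating u)
pairSum-zPairings (≡2mod4 u) e rewrite EvenView-unique e (StarSize⇒EvenView (≡2mod4 u)) | twoMod4-2mod4 u =
  cong (λ s → + 2 ⊕ (- + 1 ⊕ (- + 1 ⊕ s))) (pairSum-alternating u)

carry-consistent : ∀ c h → h ≡ c xor (c xor h)
carry-consistent true  h = sym (not-involutive h)
carry-consistent false h = refl

carry-+ : ∀ c {k} → EvenView k → ∀ N → (c xor twoMod4 k) xor twoMod4 N ≡ c xor twoMod4 (k + N)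
carry-+ c {k} ek N = trans (xor-assoc c (twoMod4 k) (twoMod4 N)) (cong (c xor_) (sym (twoMod4-+ ek N)))

-- a is the number of labels used by earlier stars; the carry c says that the
-- previous star took the label a + 1 and left a to this one.
labelling : ∀ p (n : Fin p → ℕ) → (∀ i → Fin (n i)) → ℕ → Bool → Snowflake.Edge p n → ℕ
labelling (suc p) n zr a c (zero  , j) = starLabel (n zero) c (c xor twoMod4 (n zero)) (zr zero) a j
labelling (suc p) n zr a c (suc i , j) = labelling p (n ∘ suc) (zr ∘ suc) (a + n zero) (c xor twoMod4 (n zero)) (i , j)

orienting : ∀ p (n : Fin p → ℕ) → (∀ i → Fin (n i)) → (Fin p → Bool) → Bool → Snowflake.Edge p n → Bool
orienting (suc p) n zr D c (zero  , j) = starOrientation (n zero) c (zr zero) (D zero) j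
orienting (suc p) n zr D c (suc i , j) = orienting p (n ∘ suc) (zr ∘ suc) (D ∘ suc) (c xor twoMod4 (n zero)) (i , j)

zRanks : ∀ {p} → EvenView p → (n : Fin p → ℕ) → (∀ i → StarSize (n i)) → Bool → (ℕ → Pairing) → ∀ i → Fin (n i)
zRanks (even+2 e) n sizes c t zero          = zRank₀ (sizes zero) (c xor twoMod4 (n zero)) (t 0)
zRanks (even+2 e) n sizes c t (suc zero)    = zRank₁ (sizes (suc zero)) (c xor twoMod4 (n zero)) (t 0)
zRanks (even+2 e) n sizes c t (suc (suc i)) =
  zRanks e (λ i → n (suc (suc i))) (λ i → sizes (suc (suc i))) ((c xor twoMod4 (n zero)) xor twoMod4 (n (suc zero))) (t ∘ suc) i

zDirections : ∀ {p} → EvenView p → (ℕ → Pairing) → Fin p → Bool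
zDirections (even+2 e) t zero          = zDirection (t 0)
zDirections (even+2 e) t (suc zero)    = not (zDirection (t 0))
zDirections (even+2 e) t (suc (suc i)) = zDirections e (t ∘ suc) i

labelling-vertexSum≡0 : ∀ p (n : Fin p → ℕ) → (∀ i → StarSize (n i)) → ∀ zr D a c i →
  Σℤ (n i) (λ j → signed (orienting p n zr D c (i , j)) (labelling p n zr a c (i , j))) ≡ + 0
labelling-vertexSum≡0 (suc p) n sizes zr D a c zero =
  star-vertexSum≡0 (sizes zero) c _ (carry-consistent c (twoMod4 (n zero))) (zr zero) (D zero) a
labelling-vertexSum≡0 (suc p) n sizes zr D a c (suc i) =
  labelling-vertexSum≡0 p (n ∘ suc) (sizes ∘ suc) (zr ∘ suc) (D ∘ suc) _ _ i

orienting-in≡out : ∀ p (n : Fin p → ℕ) → (∀ i → StarSize (n i)) → ∀ zr D c i →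
  Σℕ (n i) (λ j → oneIf (orienting p n zr D c (i , j))) ≡ Σℕ (n i) (λ j → oneIf (not (orienting p n zr D c (i , j))))
orienting-in≡out (suc p) n sizes zr D c zero =
  star-in≡out (sizes zero) c _ (carry-consistent c (twoMod4 (n zero))) (zr zero) (D zero)
orienting-in≡out (suc p) n sizes zr D c (suc i) =
  orienting-in≡out p (n ∘ suc) (sizes ∘ suc) (zr ∘ suc) (D ∘ suc) _ i

labelling-InBlock : ∀ p (n : Fin p → ℕ) → (∀ i → StarSize (n i)) → ∀ zr a c e →
  InBlock a c (Σℕ p n) (c xor twoMod4 (Σℕ p n)) (labelling p n zr a c e)
labelling-InBlock (suc p) n sizes zr a c (zero , j) =
  InBlock-extendʳ N' (c xor twoMod4 (k₀ + N')) (starLabel-InBlock k₀ c c₁ (zr zero) a (StarSize⇒2≤ (sizes zero)) j)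
    (λ N'≡0 → cong (λ m → c xor twoMod4 m) (trans (cong (_+_ k₀) N'≡0) (ℕₚ.+-identityʳ k₀)))
    (Σℕ≡0⊎2≤Σℕ p (n ∘ suc) (sizes ∘ suc))
  where
  k₀ = n zero
  N' = Σℕ p (n ∘ suc)
  c₁ = c xor twoMod4 k₀
labelling-InBlock (suc p) n sizes zr a c (suc i , j) =
  subst (λ cr → InBlock a c (Σℕ (suc p) n) cr (labelling (suc p) n zr a c (suc i , j))) (carry-+ c (StarSize⇒EvenView (sizes zero)) _)
    (InBlock-extendˡ c (StarSize⇒2≤ (sizes zero))
      (labelling-InBlock p (n ∘ suc) (sizes ∘ suc) (zr ∘ suc) (a + n zero) (c xor twoMod4 (n zero)) (i , j)))

labelling-first≢rest : ∀ p (n : Fin (suc p) → ℕ) → (∀ i → StarSize (n i)) → ∀ zr a c j e →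
                       labelling (suc p) n zr a c (zero , j) ≢ labelling (suc p) n zr a c (sucEdge e)
labelling-first≢rest p n sizes zr a c j e eq =
  InBlock-disjoint (starLabel-InBlock (n zero) c _ (zr zero) a (StarSize⇒2≤ (sizes zero)) j)
    (subst (InBlock _ _ _ _) (sym eq)
      (labelling-InBlock p (n ∘ suc) (sizes ∘ suc) (zr ∘ suc) (a + n zero) (c xor twoMod4 (n zero)) e))

labelling-injective : ∀ p (n : Fin p → ℕ) → (∀ i → StarSize (n i)) → ∀ zr a c → Injective _≡_ _≡_ (labelling p n zr a c)
labelling-injective (suc p) n sizes zr a c {zero , j} {zero , j'} eq =
  cong (zero ,_) (starLabel-injective (n zero) c _ (zr zero) a eq)
labelling-injective (suc p) n sizes zr a c {zero , j} {suc i' , j'} eq =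
  ⊥-elim (labelling-first≢rest p n sizes zr a c j (i' , j') eq)
labelling-injective (suc p) n sizes zr a c {suc i , j} {zero , j'} eq =
  ⊥-elim (labelling-first≢rest p n sizes zr a c j' (i , j) (sym eq))
labelling-injective (suc p) n sizes zr a c {suc i , j} {suc i' , j'} eq =
  cong (sucEdge {n = n}) (labelling-injective p (n ∘ suc) (sizes ∘ suc) (zr ∘ suc) (a + n zero) (c xor twoMod4 (n zero)) eq)

zSum : ∀ p (n : Fin p → ℕ) → (Snowflake.Edge p n → Bool) → (Snowflake.Edge p n → ℕ) → ℤ
zSum p n o φ = Σℤ p (λ i → Σℤ (n i) (λ j → if isFirst j then signed (not (o (i , j))) (φ (i , j)) else + 0))

zIn zOut : ∀ p (n : Fin p → ℕ) → (Snowflake.Edge p n → Bool) → ℕ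
zIn  p n o = Σℕ p (λ i → Σℕ (n i) (λ j → if isFirst j then oneIf (not (o (i , j))) else 0))
zOut p n o = Σℕ p (λ i → Σℕ (n i) (λ j → if isFirst j then oneIf (o (i , j)) else 0))

zSum≡pairSum : ∀ {p} (e : EvenView p) (n : Fin p → ℕ) (sizes : ∀ i → StarSize (n i)) a c t →
  zSum p n (orienting p n (zRanks e n sizes c t) (zDirections e t) c) (labelling p n (zRanks e n sizes c t) a c)
  ≡ pairSum e t
zSum≡pairSum even0 n sizes a c t = refl
zSum≡pairSum (even+2 {p} e) n sizes a c t = begin
  Z zero ⊕ (Z (suc zero) ⊕ zRest)
    ≡⟨ cong₂ (λ x y → x ⊕ (y ⊕ zRest)) Z₀ Z₁ ⟩
  signed (not D) x ⊕ (signed (not (not D)) (gap t₀ + x) ⊕ zRest)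
    ≡⟨ sym (ℤₚ.+-assoc (signed (not D) x) (signed (not (not D)) (gap t₀ + x)) zRest) ⟩
  (signed (not D) x ⊕ signed (not (not D)) (gap t₀ + x)) ⊕ zRest
    ≡⟨ cong₂ _⊕_ (pair-zSum t₀ x) (zSum≡pairSum e _ (λ i → sizes (suc (suc i))) (a + k₀ + k₁) c₂ (t ∘ suc)) ⟩
  zContribution t₀ ⊕ pairSum e (t ∘ suc) ∎
  where
  open ≡-Reasoning
  t₀ = t 0
  D = zDirection t₀
  k₀ = n zero
  k₁ = n (suc zero)
  c₁ = c xor twoMod4 k₀
  c₂ = c₁ xor twoMod4 k₁
  x = a + offset k₀ c c₁ (zRank₀ℕ k₀ c₁ t₀)
  o = orienting (2 + p) n (zRanks (even+2 e) n sizes c t) (zDirections (even+2 e) t) c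
  φ = labelling (2 + p) n (zRanks (even+2 e) n sizes c t) a c
  Z : Fin (2 + p) → ℤ
  Z i = Σℤ (n i) (λ j → if isFirst j then signed (not (o (i , j))) (φ (i , j)) else + 0)
  zRest = Σℤ p (λ i → Z (suc (suc i)))
  Z₀ : Z zero ≡ signed (not D) x
  Z₀ = trans (star-zTerm k₀ (StarSize⇒1≤ (sizes zero)) c c₁ _ D a)
             (cong (λ r → signed (not D) (a + offset k₀ c c₁ r)) (Finₚ.toℕ-fromℕ< {m = zRank₀ℕ k₀ c₁ t₀} _))
  Z₁ : Z (suc zero) ≡ signed (not (not D)) (gap t₀ + x)
  Z₁ = trans (star-zTerm k₁ (StarSize⇒1≤ (sizes (suc zero))) c₁ c₂ _ (not D) (a + k₀))
             (cong (signed (not (not D)))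
               (trans (cong (λ r → a + k₀ + offset k₁ c₁ c₂ r) (Finₚ.toℕ-fromℕ< {m = zRank₁ℕ c₁ t₀} _))
                      (zLabel-gap k₀ k₁ (StarSize⇒4≤ (sizes zero)) (StarSize⇒4≤ (sizes (suc zero))) c c₁ c₂ t₀ a)))

pair-in≡out : ∀ D {R R'} → R ≡ R' → oneIf (not D) + (oneIf (not (not D)) + R) ≡ oneIf D + (oneIf (not D) + R')
pair-in≡out true  refl = refl
pair-in≡out false refl = refl

zIn≡zOut : ∀ {p} (e : EvenView p) (n : Fin p → ℕ) (sizes : ∀ i → StarSize (n i)) c t →
  zIn p n (orienting p n (zRanks e n sizes c t) (zDirections e t) c)
  ≡ zOut p n (orienting p n (zRanks e n sizes c t) (zDirections e t) c)
zIn≡zOut even0 n sizes c t = refl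
zIn≡zOut (even+2 {p} e) n sizes c t =
  trans (cong₂ (λ x y → x + (y + rest (oneIf ∘ not))) (degree₀ (oneIf ∘ not)) (degree₁ (oneIf ∘ not)))
  (trans (pair-in≡out D (zIn≡zOut e _ (λ i → sizes (suc (suc i))) c₂ (t ∘ suc)))
         (sym (cong₂ (λ x y → x + (y + rest oneIf)) (degree₀ oneIf) (degree₁ oneIf))))
  where
  D = zDirection (t 0)
  c₁ = c xor twoMod4 (n zero)
  c₂ = c₁ xor twoMod4 (n (suc zero))
  o = orienting (2 + p) n (zRanks (even+2 e) n sizes c t) (zDirections (even+2 e) t) c
  rest : (Bool → ℕ) → ℕ
  rest B = Σℕ p (λ i → Σℕ (n (suc (suc i))) (λ j → if isFirst j then B (o (suc (suc i) , j)) else 0))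
  degree₀ : ∀ B → Σℕ (n zero) (λ j → if isFirst j then B (o (zero , j)) else 0) ≡ B D
  degree₀ = star-zDegree (n zero) (StarSize⇒1≤ (sizes zero)) c _ D
  degree₁ : ∀ B → Σℕ (n (suc zero)) (λ j → if isFirst j then B (o (suc zero , j)) else 0) ≡ B (not D)
  degree₁ = star-zDegree (n (suc zero)) (StarSize⇒1≤ (sizes (suc zero))) c₁ _ (not D)

InBlock⇒consSet : ∀ {M l} → InBlock 0 false M false l → 1 ≤ l × l ≤ M
InBlock⇒consSet (inj₁ 1≤l , inj₁ l≤M , _) = 1≤l , l≤M

InBlock⇒nearSet : ∀ {M l} → InBlock 0 false M true l → (1 ≤ l × l + 1 ≤ M) ⊎ l ≡ suc M
InBlock⇒nearSet (_      , inj₂ (_ , l≡) , _ , _)   = inj₂ l≡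
InBlock⇒nearSet {M} {l} (inj₁ 1≤l , inj₁ l≤M , _ , ≢M) =
  inj₁ (1≤l , subst (_≤ M) (ℕₚ.+-comm 1 l) (ℕₚ.≤∧≢⇒< l≤M (≢M refl)))

pred-injective : ∀ {l l'} → 1 ≤ l → 1 ≤ l' → pred l ≡ pred l' → l ≡ l'
pred-injective {suc l} {suc l'} _ _ = cong suc

nearCode : ℕ → ℕ → ℕ
nearCode M l = if does (l ℕₚ.≟ suc M) then pred M else pred l

nearCode-≢ : ∀ M l → l ≢ suc M → nearCode M l ≡ pred l
nearCode-≢ M l l≢ rewrite dec-false (l ℕₚ.≟ suc M) l≢ = refl

nearCode-M+1 : ∀ M → nearCode M (suc M) ≡ pred M
nearCode-M+1 M rewrite dec-true (suc M ℕₚ.≟ suc M) refl = refl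

+1≤⇒< : ∀ {l M} → l + 1 ≤ M → l < M
+1≤⇒< {l} {M} = subst (_≤ M) (ℕₚ.+-comm l 1)

nearCode-below : ∀ M l → l + 1 ≤ M → nearCode M l ≡ pred l
nearCode-below M l l+1≤M = nearCode-≢ M l (ℕₚ.<⇒≢ (ℕₚ.m<n⇒m<1+n (+1≤⇒< l+1≤M)))

nearCode-< : ∀ M → 1 ≤ M → ∀ l → (1 ≤ l × l + 1 ≤ M) ⊎ l ≡ suc M → nearCode M l < M
nearCode-< M _ l (inj₁ (_ , l+1≤M)) =
  subst (_< M) (sym (nearCode-below M l l+1≤M)) (ℕₚ.≤-<-trans ℕₚ.pred[n]≤n (+1≤⇒< l+1≤M))
nearCode-< (suc M) _ .(suc (suc M)) (inj₂ refl) rewrite nearCode-M+1 (suc M) = ℕₚ.≤-refl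

nearCode-injective : ∀ M → 1 ≤ M → ∀ {l l'} → (1 ≤ l × l + 1 ≤ M) ⊎ l ≡ suc M → (1 ≤ l' × l' + 1 ≤ M) ⊎ l' ≡ suc M →
                     nearCode M l ≡ nearCode M l' → l ≡ l'
nearCode-injective M _ {l} {l'} (inj₁ (1≤l , l<)) (inj₁ (1≤l' , l'<)) eq =
  pred-injective 1≤l 1≤l' (trans (sym (nearCode-below M l l<)) (trans eq (nearCode-below M l' l'<)))
nearCode-injective M 1≤M {l} (inj₁ (1≤l , l<)) (inj₂ refl) eq =
  ⊥-elim (ℕₚ.<⇒≢ (+1≤⇒< l<) (pred-injective 1≤l 1≤M (trans (sym (nearCode-below M l l<)) (trans eq (nearCode-M+1 M)))))
nearCode-injective M 1≤M {l' = l'} (inj₂ refl) (inj₁ (1≤l' , l'<)) eq =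
  ⊥-elim (ℕₚ.<⇒≢ (+1≤⇒< l'<) (pred-injective 1≤l' 1≤M (trans (sym (nearCode-below M l' l'<)) (trans (sym eq) (nearCode-M+1 M)))))
nearCode-injective M _ (inj₂ refl) (inj₂ refl) _ = refl

module _ (p : ℕ) (n : Fin p → ℕ) where
  open Snowflake p n

  sumC≡ : ∀ o φ i → sumC o φ i ≡ Σℤ (n i) (λ j → signed (o (i , j)) (φ (i , j)))
  sumC≡ o φ i = Σℤ-cong (n i) (λ j → bridge (o (i , j)) (φ (i , j)))
    where bridge : ∀ b l → atStarCenter b l ≡ signed b l
          bridge true  l = refl
          bridge false l = refl

  sumZ≡zSum : ∀ o φ → sumZ o φ ≡ zSum p n o φ
  sumZ≡zSum o φ = Σℤ-cong p (λ i → Σℤ-cong (n i) (λ j → bridge j (o (i , j)) (φ (i , j))))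
    where bridge : ∀ {k} (j : Fin k) b l → (if isZ j then atZ b l else + 0) ≡ (if isFirst j then signed (not b) l else + 0)
          bridge zero    true  l = refl
          bridge zero    false l = refl
          bridge (suc j) b     l = refl

  b2n≡oneIf : ∀ b → b2n b ≡ oneIf b
  b2n≡oneIf true  = refl
  b2n≡oneIf false = refl

  inC≡ : ∀ o i → inC o i ≡ Σℕ (n i) (λ j → oneIf (o (i , j)))
  inC≡ o i = Σℕ-cong (n i) (λ j → b2n≡oneIf (o (i , j)))

  outC≡ : ∀ o i → outC o i ≡ Σℕ (n i) (λ j → oneIf (not (o (i , j))))
  outC≡ o i = Σℕ-cong (n i) (λ j → b2n≡oneIf (not (o (i , j))))

  zBridge : ∀ {k} (j : Fin k) b → (if isZ j then b2n b else 0) ≡ (if isFirst j then oneIf b else 0)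
  zBridge zero    b = b2n≡oneIf b
  zBridge (suc j) b = refl

  inZ≡zIn : ∀ o → inZ o ≡ zIn p n o
  inZ≡zIn o = Σℕ-cong p (λ i → Σℕ-cong (n i) (λ j → zBridge j (not (o (i , j)))))

  outZ≡zOut : ∀ o → outZ o ≡ zOut p n o
  outZ≡zOut o = Σℕ-cong p (λ i → Σℕ-cong (n i) (λ j → zBridge j (o (i , j))))

  IsLabeling-by-counting : ∀ (φ : Edge → ℕ) → Injective _≡_ _≡_ φ → (S : ℕ → Set) → (∀ e → S (φ e)) →
                           (code : ℕ → ℕ) → (∀ l → S l → code l < M) →
                           (∀ {l l'} → S l → S l' → code l ≡ code l' → l ≡ l') → IsLabeling S φ
  IsLabeling-by-counting φ φ-inj S φ∈S code code<M code-inj =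
    φ-inj , φ∈S , onto-by-counting M (enumerate p n) (enumerate-injective p n) φ φ-inj S φ∈S code code<M code-inj

module Construction (p : ℕ) (n : Fin p → ℕ) (sizes : ∀ i → StarSize (n i)) (even-p : Even p) where
  open Snowflake p n

  view : EvenView p
  view = evenView p even-p

  ranks : ∀ i → Fin (n i)
  ranks = zRanks view n sizes false (zPairings p)

  o : Orientation
  o = orienting p n ranks (zDirections view (zPairings p)) false

  φ : Edge → ℕ
  φ = labelling p n ranks 0 false

  zeroSums : ZeroSums o φ
  zeroSums = (λ i _ → trans (sumC≡ p n o φ i) (labelling-vertexSum≡0 p n sizes ranks _ 0 false i))
           , (λ 3≤p → trans (sumZ≡zSum p n o φ)
                       (trans (zSum≡pairSum view n sizes 0 false _) (pairSum-zPairings (starSize p even-p 3≤p) view)))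

  eulerian : IsEulerian o
  eulerian = (λ i _ → trans (inC≡ p n o i) (trans (orienting-in≡out p n sizes ranks _ false i) (sym (outC≡ p n o i))))
           , (λ _ → trans (inZ≡zIn p n o) (trans (zIn≡zOut view n sizes false _) (sym (outZ≡zOut p n o))))

  φ-InBlock : ∀ e → InBlock 0 false M (twoMod4 M) (φ e)
  φ-InBlock = labelling-InBlock p n sizes ranks 0 false

  φ-injective : Injective _≡_ _≡_ φ
  φ-injective = labelling-injective p n sizes ranks 0 false

  conservative : twoMod4 M ≡ false → EulerianConservative
  conservative M≢2 = o , φ , IsLabeling-by-counting p n φ φ-injective ConsSet φ∈ pred pred<M pred-inj , zeroSums , eulerian
    where
    φ∈ : ∀ e → ConsSet (φ e)
    φ∈ e = InBlock⇒consSet (subst (λ cr → InBlock 0 false M cr (φ e)) M≢2 (φ-InBlock e))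
    pred<M : ∀ l → ConsSet l → pred l < M
    pred<M (suc l) (_ , l<M) = l<M
    pred-inj : ∀ {l l'} → ConsSet l → ConsSet l' → pred l ≡ pred l' → l ≡ l'
    pred-inj (1≤l , _) (1≤l' , _) = pred-injective 1≤l 1≤l'

  nearConservative : 1 ≤ M → twoMod4 M ≡ true → EulerianNearConservative
  nearConservative 1≤M M≡2 =
    o , φ , IsLabeling-by-counting p n φ φ-injective NearSet φ∈ (nearCode M) (nearCode-< M 1≤M) (nearCode-injective M 1≤M)
      , zeroSums , eulerian
    where
    φ∈ : ∀ e → NearSet (φ e)
    φ∈ e = InBlock⇒nearSet (subst (λ cr → InBlock 0 false M cr (φ e)) M≡2 (φ-InBlock e))

lemma27 : (p : ℕ) (n : Fin p → ℕ)
          → 1 ≤ p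
          → (∀ i → 3 ≤ n i)
          → (∀ i → Even (n i))
          → Even p
          → (Snowflake.M p n % 4 ≡ 0 → Snowflake.EulerianConservative p n)
            × (¬ (Snowflake.M p n % 4 ≡ 0) → Snowflake.EulerianNearConservative p n)
lemma27 p n 1≤p 3≤n even-n even-p = whenM%4≡0 , whenM%4≢0
  where
  sizes : ∀ i → StarSize (n i)
  sizes i = starSize (n i) (even-n i) (3≤n i)
  open Construction p n sizes even-p
  whenM%4≡0 : Snowflake.M p n % 4 ≡ 0 → Snowflake.EulerianConservative p n
  whenM%4≡0 M%4≡0 with twoMod4-%4 (Σℕ-EvenView p n sizes)
  ... | inj₁ (M≢2 , _)      = conservative M≢2
  ... | inj₂ (_ , M%4≡2) with () ← trans (sym M%4≡2) M%4≡0
  whenM%4≢0 : ¬ (Snowflake.M p n % 4 ≡ 0) → Snowflake.EulerianNearConservative p n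
  whenM%4≢0 M%4≢0 with twoMod4-%4 (Σℕ-EvenView p n sizes)
  ... | inj₁ (_ , M%4≡0)    = ⊥-elim (M%4≢0 M%4≡0)
  ... | inj₂ (M≡2 , _)      = nearConservative (1≤Σℕ p n 1≤p sizes) M≡2
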